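{- Let $\mathbb{B}\in\mathcal{V}(\mathbb{A}'(\mathcal{T}))$ and $c,d\in B$. Suppose $r=r_1,r_2,\ldots,r_n=s$ are elements of $B$ with $r_{i+1}\le r_i$ for all $i$, such that $(r_i,r_{i+1})\in\mathrm{Cg}^{\mathbb{B}}(c,d)$ for all $i$, and there are $p_1,q_1,\dots,p_{n-1},q_{n-1}\in B$ with $r_i=J(p_i,q_i,r_i)$ and $r_{i+1}=J(p_i,q_i,r_{i+1})$ for $1\le i\le n-1$. Then there exists $\rho\in B$ such that $r=J(r,\rho,r')$ and $s=J(r,\rho,s')$, where $r'=e_2(r,\rho,r)$ and $s'=e_2(r,\rho,s)$.
   Context: $\mathcal{T}$ is a Turing machine with states $\mu_0,\dots,\mu_n$ and $\mathbb{A}'(\mathcal{T})$ is the following algebra; $\mathcal{V}(\mathbb{A}'(\mathcal{T}))$ is the variety it generates, whose members interpret the same operation symbols; $\le$ denotes the meet-semilattice order ($x\le y$ iff $x\wedge y=x$). Let $U=\{1,2,H\}$, $W=\{C,D,\partial C,\partial D\}$, $A=\{0\}\cup U\cup W$; for $0\le i\le n$ and $r,s\in\{0,1\}$ let $V_{ir}^s=\{C_{ir}^s,D_{ir}^s,M_i^r,\partial C_{ir}^s,\partial D_{ir}^s,\partial M_i^r\}$, $V_{ir}=V_{ir}^0\cup V_{ir}^1$, $V_i=V_{i0}\cup V_{i1}$, $V=\bigcup_i V_i$ (all symbols distinct). The universe is $A\cup V$. $\partial$ denotes the involution of $V\cup W$ exchanging $x$ and $\partial x$; it is not an operation. Fundamental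 operations: - constant $0$ and $\wedge$ making a flat meet semilattice with bottom $0$; for $p,q$ each equal to $x$ or $0$, $p\vee q$ is their join. - multiplication: $2\cdot D=H\cdot C=D$, $1\cdot C=C$, $2\cdot\partial D=H\cdot\partial C=\partial D$, $1\cdot\partial C=\partial C$, else $0$. - $J(x,y,z)=x$ if $x=y$; $x\wedge z$ if $x=\partial y\in V\cup W$; $0$ otherwise. $J'(x,y,z)=x\wedge z$ if $x=y$; $x$ if $x=\partial y\in V\cup W$; $0$ otherwise. $K(x,y,z)=y$ if $x=\partial y\in V\cup W$; $z$ if $x=y=\partial z\in V\cup W$; $x\wedge y\wedge z$ otherwise. - $S_0(u,x,y,z)=(x\wedge y)\vee(x\wedge z)$ if $u\in V_0$, else $0$; $S_1(u,x,y,z)=(x\wedge y)\vee(x\wedge z)$ if $u\in\{1,2\}$, else $0$; $S_2(u,v,x,y,z)=(x\wedge y)\vee(x\wedge z)$ if $u=\partial v\in V\cup W$, else $0$. - $T(w,x,y,z)=w\cdot x$ if $w\cdot x=y\cdot z$ and $(w,x)=(y,z)$; $\partial(w\cdot x)$ if $w\cdot x=y\cdot z\ne0$ and $(w,x)\ne(y,z)$; $0$ otherwise. - $I(x)=C_{10}^0$ if $x=1$, $M_1^0$ if $x=H$, $D_{10}^0$ if $x=2$, else $0$. - for each instruction $(\mu_i,r,s,\mathrm{L},\mu_j)$ of $\mathcal{T}$ and $t\in\{0,1\}$: $L_{irt}(x,y,u)=C_{jt}^{s'}$ if $x=y=1$, $u=C_{ir}^{s'}$; $M_j^t$ if $x=H,y=1,u=C_{ir}^t$;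 $D_{jt}^s$ if $x=2,y=H,u=M_i^r$; $D_{jt}^{s'}$ if $x=y=2,u=D_{ir}^{s'}$; $\partial v$ if $u\in V$ and $L_{irt}(x,y,\partial u)=v\in V$ by the preceding clauses; $0$ otherwise. - for each instruction $(\mu_i,r,s,\mathrm{R},\mu_j)$ and $t\in\{0,1\}$: $R_{irt}(x,y,u)=C_{jt}^{s'}$ if $x=y=1,u=C_{ir}^{s'}$; $C_{jt}^s$ if $x=H,y=1,u=M_i^r$; $M_j^t$ if $x=2,y=H,u=D_{ir}^t$; $D_{jt}^{s'}$ if $x=y=2,u=D_{ir}^{s'}$; $\partial v$ if $u\in V$ and $R_{irt}(x,y,\partial u)=v\in V$ by the preceding clauses; $0$ otherwise. - with $\mathcal{L},\mathcal{R}$ the sets of these operations and $x\prec y$ iff $(x,y)\in\{(2,2),(2,H),(1,1)\}$, for each $F\in\mathcal{L}\cup\mathcal{R}$: $U_F^1(x,y,z,u)=\partial F(x,y,u)$ if $x\prec z,y\ne z,F(x,y,u)\ne0$; $F(x,y,u)$ if $x\prec z,y=z,F(x,y,u)\ne0$; $0$ otherwise; and $U_F^0(x,y,z,u)=\partial F(y,z,u)$ if $x\prec z,x\ne y,F(y,z,u)\ne0$; $F(y,z,u)$ if $x\prec z,x=y,F(y,z,u)\ne0$; $0$ otherwise. Term: $e_2(m,n,x)=S_2(m,n,x,x,x)$. -}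

module Defs where

open import Level using (Level; _⊔_; 0ℓ) renaming (suc to lsuc)
open import Data.Nat using (ℕ; zero; suc)
open import Data.Fin using (Fin; zero; suc) renaming (_≟_ to _≟ᶠ_)
open import Data.Bool using (Bool; true; false; not; if_then_else_; _∧_; _∨_)
open import Data.Maybe using (Maybe; just; nothing; maybe)
open import Data.Product using (Σ; ∃; _×_; _,_; proj₁; proj₂)
open import Data.Vec using (Vec; []; _∷_; map)
open import Data.Vec.Relation.Binary.Pointwise.Inductive using (Pointwise)
open import Relation.Nullary using (Dec; yes; no; does)
open import Relation.Nullary.Decidable using (map′; _×-dec_)
open import Relation.Binary.PropositionalEquality using (_≡_; refl)
open import Relation.Binary using (Rel; IsEquivalence)

Bit : Set
Bit = Fin 2

data Dir : Set where
  L R : Dir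

-- States μ₀,…,μₙ with n ≥ 1 (the construction uses μ₁):
-- a machine with parameter k has states Fin (2 + k), i.e. n = k + 1.
-- An instruction (μᵢ , r , s , D , μⱼ).
record Instr (k : ℕ) : Set where
  constructor ⟨_,_,_,_,_⟩
  field
    src   : Fin (suc (suc k))
    read  : Bit
    write : Bit
    dir   : Dir
    tgt   : Fin (suc (suc k))

record TM : Set where
  field
    k        : ℕ
    numInstr : ℕ
    instr    : Fin numInstr → Instr k

module _ (𝒯 : TM) where
  open TM 𝒯

  St : Set
  St = Fin (suc (suc k))

  st1 : St
  st1 = suc zero

  -- "cores" of the elements of W ∪ V; an element of W ∪ V is a core with
  -- a sign: sg true c = c, sg false c = ∂c.
  --   cW = C, dW = D, cV i r s = Cᵢᵣˢ, dV i r s = Dᵢᵣˢ, mV i r = Mᵢʳ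
  data Core : Set where
    cW dW : Core
    cV dV : St → Bit → Bit → Core
    mV    : St → Bit → Core

  data Elem : Set where
    𝟘 𝟙 𝟚 𝐇 : Elem
    sg : Bool → Core → Elem

  _≟ᶜ_ : (x y : Core) → Dec (x ≡ y)
  cW ≟ᶜ cW = yes refl
  dW ≟ᶜ dW = yes refl
  cV i r s ≟ᶜ cV i' r' s' =
    map′ (λ { (refl , refl , refl) → refl }) (λ { refl → refl , refl , refl })
         ((i ≟ᶠ i') ×-dec ((r ≟ᶠ r') ×-dec (s ≟ᶠ s')))
  dV i r s ≟ᶜ dV i' r' s' =
    map′ (λ { (refl , refl , refl) → refl }) (λ { refl → refl , refl , refl })
         ((i ≟ᶠ i') ×-dec ((r ≟ᶠ r') ×-dec (s ≟ᶠ s')))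
  mV i r ≟ᶜ mV i' r' =
    map′ (λ { (refl , refl) → refl }) (λ { refl → refl , refl })
         ((i ≟ᶠ i') ×-dec (r ≟ᶠ r'))
  cW ≟ᶜ dW = no (λ ())
  cW ≟ᶜ (cV _ _ _) = no (λ ())
  cW ≟ᶜ (dV _ _ _) = no (λ ())
  cW ≟ᶜ (mV _ _) = no (λ ())
  dW ≟ᶜ cW = no (λ ())
  dW ≟ᶜ (cV _ _ _) = no (λ ())
  dW ≟ᶜ (dV _ _ _) = no (λ ())
  dW ≟ᶜ (mV _ _) = no (λ ())
  (cV _ _ _) ≟ᶜ cW = no (λ ())
  (cV _ _ _) ≟ᶜ dW = no (λ ())
  (cV _ _ _) ≟ᶜ (dV _ _ _) = no (λ ())
  (cV _ _ _) ≟ᶜ (mV _ _) = no (λ ())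
  (dV _ _ _) ≟ᶜ cW = no (λ ())
  (dV _ _ _) ≟ᶜ dW = no (λ ())
  (dV _ _ _) ≟ᶜ (cV _ _ _) = no (λ ())
  (dV _ _ _) ≟ᶜ (mV _ _) = no (λ ())
  (mV _ _) ≟ᶜ cW = no (λ ())
  (mV _ _) ≟ᶜ dW = no (λ ())
  (mV _ _) ≟ᶜ (cV _ _ _) = no (λ ())
  (mV _ _) ≟ᶜ (dV _ _ _) = no (λ ())

  _≟b_ : (x y : Bool) → Dec (x ≡ y)
  true ≟b true = yes refl
  false ≟b false = yes refl
  true ≟b false = no (λ ())
  false ≟b true = no (λ ())

  _≟ᵉ_ : (x y : Elem) → Dec (x ≡ y)
  𝟘 ≟ᵉ 𝟘 = yes refl
  𝟙 ≟ᵉ 𝟙 = yes refl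
  𝟚 ≟ᵉ 𝟚 = yes refl
  𝐇 ≟ᵉ 𝐇 = yes refl
  sg σ c ≟ᵉ sg σ' c' =
    map′ (λ { (refl , refl) → refl }) (λ { refl → refl , refl })
         ((σ ≟b σ') ×-dec (c ≟ᶜ c'))
  𝟘 ≟ᵉ 𝟙 = no (λ ())
  𝟘 ≟ᵉ 𝟚 = no (λ ())
  𝟘 ≟ᵉ 𝐇 = no (λ ())
  𝟘 ≟ᵉ (sg _ _) = no (λ ())
  𝟙 ≟ᵉ 𝟘 = no (λ ())
  𝟙 ≟ᵉ 𝟚 = no (λ ())
  𝟙 ≟ᵉ 𝐇 = no (λ ())
  𝟙 ≟ᵉ (sg _ _) = no (λ ())
  𝟚 ≟ᵉ 𝟘 = no (λ ())
  𝟚 ≟ᵉ 𝟙 = no (λ ())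
  𝟚 ≟ᵉ 𝐇 = no (λ ())
  𝟚 ≟ᵉ (sg _ _) = no (λ ())
  𝐇 ≟ᵉ 𝟘 = no (λ ())
  𝐇 ≟ᵉ 𝟙 = no (λ ())
  𝐇 ≟ᵉ 𝟚 = no (λ ())
  𝐇 ≟ᵉ (sg _ _) = no (λ ())
  (sg _ _) ≟ᵉ 𝟘 = no (λ ())
  (sg _ _) ≟ᵉ 𝟙 = no (λ ())
  (sg _ _) ≟ᵉ 𝟚 = no (λ ())
  (sg _ _) ≟ᵉ 𝐇 = no (λ ())

  _==_ : Elem → Elem → Bool
  x == y = does (x ≟ᵉ y)

  -- the involution ∂ on V ∪ W (identity elsewhere; only used on V ∪ W)
  ∂ : Elem → Elem
  ∂ (sg σ c) = sg (not σ) c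
  ∂ x = x

  isDual : Elem → Elem → Bool
  isDual (sg σ c) (sg σ' c') = does (σ ≟b not σ') ∧ does (c ≟ᶜ c')
  isDual _ _ = false

  inV₀ : Elem → Bool
  inV₀ (sg _ (cV i _ _)) = does (i ≟ᶠ zero)
  inV₀ (sg _ (dV i _ _)) = does (i ≟ᶠ zero)
  inV₀ (sg _ (mV i _))   = does (i ≟ᶠ zero)
  inV₀ _ = false

  in12 : Elem → Bool
  in12 𝟙 = true
  in12 𝟚 = true
  in12 _ = false

  meet : Elem → Elem → Elem
  meet x y = if x == y then x else 𝟘

  -- join of p, q where each is x or 0
  join : Elem → Elem → Elem
  join p q = if p == 𝟘 then q else p

  mul : Elem → Elem → Elem
  mul 𝟚 (sg σ dW) = sg σ dW
  mul 𝐇 (sg σ cW) = sg σ dW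
  mul 𝟙 (sg σ cW) = sg σ cW
  mul _ _ = 𝟘

  opJ : Elem → Elem → Elem → Elem
  opJ x y z = if x == y then x else (if isDual x y then meet x z else 𝟘)

  opJ' : Elem → Elem → Elem → Elem
  opJ' x y z = if x == y then meet x z else (if isDual x y then x else 𝟘)

  opK : Elem → Elem → Elem → Elem
  opK x y z =
    if isDual x y then y
    else (if (x == y) ∧ isDual y z then z else meet (meet x y) z)

  S-body : Elem → Elem → Elem → Elem
  S-body x y z = join (meet x y) (meet x z)

  opS₀ : Elem → Elem → Elem → Elem → Elem
  opS₀ u x y z = if inV₀ u then S-body x y z else 𝟘

  opS₁ : Elem → Elem → Elem → Elem → Elem
  opS₁ u x y z = if in12 u then S-body x y z else 𝟘

  opS₂ : Elem → Elem → Elem → Elem → Elem → Elem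
  opS₂ u v x y z = if isDual u v then S-body x y z else 𝟘

  opT : Elem → Elem → Elem → Elem → Elem
  opT w x y z =
    if (mul w x == mul y z) ∧ ((w == y) ∧ (x == z)) then mul w x
    else (if (mul w x == mul y z) ∧ not (mul w x == 𝟘) then ∂ (mul w x) else 𝟘)

  opI : Elem → Elem
  opI 𝟙 = sg true (cV st1 zero zero)
  opI 𝐇 = sg true (mV st1 zero)
  opI 𝟚 = sg true (dV st1 zero zero)
  opI _ = 𝟘

  _=ᶠ_ : {m : ℕ} → Fin m → Fin m → Bool
  a =ᶠ b = does (a ≟ᶠ b)

  -- L_{irt} on an unsigned (positive) core of V, for instruction
  -- (μᵢ, r, s, L, μⱼ); nothing means "not covered by the clauses".
  Lbase : St → Bit → Bit → St → Bit → Elem → Elem → Core → Maybe Core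
  Lbase i r s j t 𝟙 𝟙 (cV i' r' s') =
    if (i' =ᶠ i) ∧ (r' =ᶠ r) then just (cV j t s') else nothing
  Lbase i r s j t 𝐇 𝟙 (cV i' r' s') =
    if (i' =ᶠ i) ∧ ((r' =ᶠ r) ∧ (s' =ᶠ t)) then just (mV j t) else nothing
  Lbase i r s j t 𝟚 𝐇 (mV i' r') =
    if (i' =ᶠ i) ∧ (r' =ᶠ r) then just (dV j t s) else nothing
  Lbase i r s j t 𝟚 𝟚 (dV i' r' s') =
    if (i' =ᶠ i) ∧ (r' =ᶠ r) then just (dV j t s') else nothing
  Lbase _ _ _ _ _ _ _ _ = nothing

  Rbase : St → Bit → Bit → St → Bit → Elem → Elem → Core → Maybe Core
  Rbase i r s j t 𝟙 𝟙 (cV i' r' s') =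
    if (i' =ᶠ i) ∧ (r' =ᶠ r) then just (cV j t s') else nothing
  Rbase i r s j t 𝐇 𝟙 (mV i' r') =
    if (i' =ᶠ i) ∧ (r' =ᶠ r) then just (cV j t s) else nothing
  Rbase i r s j t 𝟚 𝐇 (dV i' r' s') =
    if (i' =ᶠ i) ∧ ((r' =ᶠ r) ∧ (s' =ᶠ t)) then just (mV j t) else nothing
  Rbase i r s j t 𝟚 𝟚 (dV i' r' s') =
    if (i' =ᶠ i) ∧ (r' =ᶠ r) then just (dV j t s') else nothing
  Rbase _ _ _ _ _ _ _ _ = nothing

  base : Instr k → Bit → Elem → Elem → Core → Maybe Core
  base ⟨ i , r , s , L , j ⟩ t = Lbase i r s j t
  base ⟨ i , r , s , R , j ⟩ t = Rbase i r s j t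

  -- On u = sg true c ∈ V the preceding
  -- clauses apply directly; on u = sg false c = ∂(sg true c) the value is
  -- ∂ of the value at ∂u (the "∂v" clause); otherwise 0.
  opF : Fin numInstr → Bit → Elem → Elem → Elem → Elem
  opF ι t x y (sg σ c) = maybe (sg σ) 𝟘 (base (instr ι) t x y c)
  opF ι t x y _ = 𝟘

  prec : Elem → Elem → Bool
  prec 𝟚 𝟚 = true
  prec 𝟚 𝐇 = true
  prec 𝟙 𝟙 = true
  prec _ _ = false

  opU₁ : Fin numInstr → Bit → Elem → Elem → Elem → Elem → Elem
  opU₁ ι t x y z u =
    if prec x z ∧ not (opF ι t x y u == 𝟘)
    then (if y == z then opF ι t x y u else ∂ (opF ι t x y u))
    else 𝟘

  opU₀ : Fin numInstr → Bit → Elem → Elem → Elem → Elem → Elem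
  opU₀ ι t x y z u =
    if prec x z ∧ not (opF ι t y z u == 𝟘)
    then (if x == y then opF ι t y z u else ∂ (opF ι t y z u))
    else 𝟘

  data Op : Set where
    o𝟘 o∧ o· oJ oJ' oK oS₀ oS₁ oS₂ oT oI : Op
    oF oU¹ oU⁰ : Fin numInstr → Bit → Op

  arity : Op → ℕ
  arity o𝟘 = 0
  arity o∧ = 2
  arity o· = 2
  arity oJ = 3
  arity oJ' = 3
  arity oK = 3
  arity oS₀ = 4
  arity oS₁ = 4
  arity oS₂ = 5
  arity oT = 4
  arity oI = 1
  arity (oF _ _) = 3
  arity (oU¹ _ _) = 4
  arity (oU⁰ _ _) = 4

  ⟦_⟧ᴬ : (o : Op) → Vec Elem (arity o) → Elem
  ⟦ o𝟘 ⟧ᴬ [] = 𝟘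
  ⟦ o∧ ⟧ᴬ (x ∷ y ∷ []) = meet x y
  ⟦ o· ⟧ᴬ (x ∷ y ∷ []) = mul x y
  ⟦ oJ ⟧ᴬ (x ∷ y ∷ z ∷ []) = opJ x y z
  ⟦ oJ' ⟧ᴬ (x ∷ y ∷ z ∷ []) = opJ' x y z
  ⟦ oK ⟧ᴬ (x ∷ y ∷ z ∷ []) = opK x y z
  ⟦ oS₀ ⟧ᴬ (u ∷ x ∷ y ∷ z ∷ []) = opS₀ u x y z
  ⟦ oS₁ ⟧ᴬ (u ∷ x ∷ y ∷ z ∷ []) = opS₁ u x y z
  ⟦ oS₂ ⟧ᴬ (u ∷ v ∷ x ∷ y ∷ z ∷ []) = opS₂ u v x y z
  ⟦ oT ⟧ᴬ (w ∷ x ∷ y ∷ z ∷ []) = opT w x y z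
  ⟦ oI ⟧ᴬ (x ∷ []) = opI x
  ⟦ oF ι t ⟧ᴬ (x ∷ y ∷ u ∷ []) = opF ι t x y u
  ⟦ oU¹ ι t ⟧ᴬ (x ∷ y ∷ z ∷ u ∷ []) = opU₁ ι t x y z u
  ⟦ oU⁰ ι t ⟧ᴬ (x ∷ y ∷ z ∷ u ∷ []) = opU₀ ι t x y z u

  -- Algebras of this signature (setoid-based, since quotients are not
  -- available), the variety 𝒱(A'(𝒯)) as HSP(A'(𝒯)), and congruences.

  record Algebra (a ℓ : Level) : Set (lsuc (a ⊔ ℓ)) where
    field
      Carrier       : Set a
      _≈_           : Rel Carrier ℓ
      isEquivalence : IsEquivalence _≈_
      ⟦_⟧           : (o : Op) → Vec Carrier (arity o) → Carrier
      ⟦⟧-cong       : (o : Op) {xs ys : Vec Carrier (arity o)} →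
                      Pointwise _≈_ xs ys → ⟦ o ⟧ xs ≈ ⟦ o ⟧ ys

  -- 𝔹 ∈ 𝒱(A'(𝒯)) = HSP(A'(𝒯)):  𝔹 is a homomorphic image of a
  -- subalgebra 𝕊 of a power A'(𝒯)^I.  𝕊 is given by a subset P of
  -- I → Elem closed under the (pointwise) operations, and h : 𝕊 → 𝔹 is a
  -- surjective homomorphism (respecting equality of 𝕊).
  record InV {a ℓ : Level} (𝔹 : Algebra a ℓ) : Set (lsuc a ⊔ ℓ) where
    open Algebra 𝔹
    field
      I        : Set a
      P        : (I → Elem) → Set a
      P-closed : (o : Op) (xs : Vec (Σ (I → Elem) P) (arity o)) →
                 P (λ κ → ⟦ o ⟧ᴬ (map (λ x → proj₁ x κ) xs))
    S : Set a
    S = Σ (I → Elem) P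
    opS : (o : Op) → Vec S (arity o) → S
    opS o xs = (λ κ → ⟦ o ⟧ᴬ (map (λ x → proj₁ x κ) xs)) , P-closed o xs
    field
      h      : S → Carrier
      h-cong : (x y : S) → ((κ : I) → proj₁ x κ ≡ proj₁ y κ) → h x ≈ h y
      h-hom  : (o : Op) (xs : Vec S (arity o)) → h (opS o xs) ≈ ⟦ o ⟧ (map h xs)
      h-surj : (b : Carrier) → ∃ λ x → h x ≈ b

  module _ {a ℓ : Level} (𝔹 : Algebra a ℓ) where
    open Algebra 𝔹

    data Cg (c d : Carrier) : Carrier → Carrier → Set (a ⊔ ℓ) where
      cg-base  : Cg c d c d
      cg-≈     : {x y : Carrier} → x ≈ y → Cg c d x y
      cg-sym   : {x y : Carrier} → Cg c d x y → Cg c d y x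
      cg-trans : {x y z : Carrier} → Cg c d x y → Cg c d y z → Cg c d x z
      cg-compat : (o : Op) {xs ys : Vec Carrier (arity o)} →
                  Pointwise (Cg c d) xs ys → Cg c d (⟦ o ⟧ xs) (⟦ o ⟧ ys)

    Jᴮ : Carrier → Carrier → Carrier → Carrier
    Jᴮ x y z = ⟦ oJ ⟧ (x ∷ y ∷ z ∷ [])

    e₂ᴮ : Carrier → Carrier → Carrier → Carrier
    e₂ᴮ m n x = ⟦ oS₂ ⟧ (m ∷ n ∷ x ∷ x ∷ x ∷ [])

    _≤ᴮ_ : Carrier → Carrier → Set ℓ
    x ≤ᴮ y = ⟦ o∧ ⟧ (x ∷ y ∷ []) ≈ x

module Submission where

-- Call a, x ∈ 𝔹 linked by ρ when a ≈ J(a,ρ,a) and x ≈ J(a,ρ,x).  Since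
-- J(u,v,e₂(u,v,w)) = J(u,v,w) holds in A'(𝒯), the conclusion says exactly that
-- r₀ and rₘ are linked by ρ.  Linking is reflexive (a, a, a), every step of the
-- chain links rᵢ to rᵢ₊₁ (by qᵢ), and a link a —ρ→ x followed by x —q→ y gives
-- a link a —K(a,ρ,q)→ y; so ρ is obtained by folding K along the chain.
--
-- Each of these facts is derived from a handful of identities of A'(𝒯).

open import Defs
open import Level using (Level)
open import Data.Nat using (ℕ; zero; suc; _<_; _≤_)
open import Data.Nat.Properties using (≤-refl; <⇒≤)
open import Data.Fin using (Fin)
open import Data.Fin.Patterns using (0F; 1F; 2F; 3F; 4F)
open import Data.Bool using (Bool; true; false; if_then_else_; _∧_)
open import Data.Bool.Properties using (if-eta)
open import Data.Vec using (Vec; []; _∷_; map; lookup)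
open import Data.Vec.Properties using (lookup-map)
open import Data.Vec.Relation.Binary.Pointwise.Inductive as Pointwise using (Pointwise; []; _∷_)
open import Data.Product using (Σ; ∃; _×_; _,_; proj₁; proj₂)
open import Data.Sum using (_⊎_; inj₁; inj₂)
open import Relation.Nullary using (yes; no)
open import Relation.Nullary.Decidable using (dec-true; dec-false)
open import Relation.Binary using (Setoid; IsEquivalence)
open import Relation.Binary.PropositionalEquality using (_≡_; refl; sym; trans; cong; cong₂; subst)
import Relation.Binary.Reasoning.Setoid as SetoidReasoning

if-true : ∀ {A : Set} {b : Bool} {t e : A} → b ≡ true → (if b then t else e) ≡ t
if-true refl = refl

if-false : ∀ {A : Set} {b : Bool} {t e : A} → b ≡ false → (if b then t else e) ≡ e
if-false refl = refl

-- The elements built when two links a —ρ→ x and x —q→ y are composed, written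
-- once for any interpretation of J and J' (elements of A'(𝒯), of 𝔹, or terms):
-- the normal forms â = J(a,ρ,a), x̃ = J(x̂,q,x̂) with x̂ = J(â,ρ,x), and the new
-- starting point s = J'(â,ρ,x̃), which is a again whenever a is linked to x.
module Construction {c : Level} {X : Set c} (J J' : X → X → X → X) where

  hat : X → X → X
  hat a ρ = J a ρ a

  tilde : X → X → X → X → X
  tilde a ρ x q = J (J (hat a ρ) ρ x) q (J (hat a ρ) ρ x)

  anchor : X → X → X → X → X
  anchor a ρ x q = J' (hat a ρ) ρ (tilde a ρ x q)

-- Computations in A'(𝒯).  Its meet semilattice is flat, and J, J', K only
-- distinguish whether x = y, x = ∂y, or neither (the view Position below).
module A′ (𝒯 : TM) where

  E : Set
  E = Elem 𝒯

  _⊓_ : E → E → E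
  x ⊓ y = meet 𝒯 x y

  J J' K : E → E → E → E
  J x y z = opJ 𝒯 x y z
  J' x y z = opJ' 𝒯 x y z
  K x y z = opK 𝒯 x y z

  e₂ : E → E → E → E
  e₂ u v w = opS₂ 𝒯 u v w w w

  open Construction J J'

  ==-refl : ∀ x → _==_ 𝒯 x x ≡ true
  ==-refl x = dec-true (_≟ᵉ_ 𝒯 x x) refl

  isDual-irrefl : ∀ x → isDual 𝒯 x x ≡ false
  isDual-irrefl (sg true c) = refl
  isDual-irrefl (sg false c) = refl
  isDual-irrefl 𝟘 = refl
  isDual-irrefl 𝟙 = refl
  isDual-irrefl 𝟚 = refl
  isDual-irrefl 𝐇 = refl

  record Dual (x y : E) : Set where
    constructor dualPair
    field
      distinct : _==_ 𝒯 x y ≡ false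
      dualised : isDual 𝒯 x y ≡ true

  record Unrelated (x y : E) : Set where
    constructor unrelatedPair
    field
      distinct    : _==_ 𝒯 x y ≡ false
      notDualised : isDual 𝒯 x y ≡ false

  data Position : E → E → Set where
    equal     : ∀ x → Position x x
    dual      : ∀ {x y} → Dual x y → Position x y
    unrelated : ∀ {x y} → Unrelated x y → Position x y

  position : ∀ x y → Position x y
  position x y with _≟ᵉ_ 𝒯 x y | isDual 𝒯 x y in d
  ... | yes refl | _     = equal x
  ... | no x≢y   | true  = dual (dualPair (dec-false (_≟ᵉ_ 𝒯 x y) x≢y) d)
  ... | no x≢y   | false = unrelated (unrelatedPair (dec-false (_≟ᵉ_ 𝒯 x y) x≢y) d)

  _⊑_ : E → E → Set
  u ⊑ a = u ≡ a ⊎ u ≡ 𝟘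

  ⊓-idem : ∀ x → x ⊓ x ≡ x
  ⊓-idem x = if-true (==-refl x)

  ⊓-zeroˡ : ∀ z → 𝟘 ⊓ z ≡ 𝟘
  ⊓-zeroˡ z = if-eta (_==_ 𝒯 𝟘 z)

  ⊓-zeroʳ : ∀ x → x ⊓ 𝟘 ≡ 𝟘
  ⊓-zeroʳ x with _≟ᵉ_ 𝒯 x 𝟘
  ... | yes x≡𝟘 = x≡𝟘
  ... | no _    = refl

  ⊑-trans : ∀ {u v w} → u ⊑ v → v ⊑ w → u ⊑ w
  ⊑-trans (inj₁ refl) v⊑w = v⊑w
  ⊑-trans (inj₂ refl) _   = inj₂ refl

  ⊑-𝟘 : ∀ {u} → u ⊑ 𝟘 → u ≡ 𝟘
  ⊑-𝟘 (inj₁ u≡𝟘) = u≡𝟘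
  ⊑-𝟘 (inj₂ u≡𝟘) = u≡𝟘

  ⊓-lowerˡ : ∀ x w → (x ⊓ w) ⊑ x
  ⊓-lowerˡ x w with _≟ᵉ_ 𝒯 x w
  ... | yes _ = inj₁ refl
  ... | no _  = inj₂ refl

  ⊓-absorb : ∀ {x u} → u ⊑ x → x ⊓ u ≡ u
  ⊓-absorb {x} (inj₁ refl) = ⊓-idem x
  ⊓-absorb {x} (inj₂ refl) = ⊓-zeroʳ x

  J-equal : ∀ x z → J x x z ≡ x
  J-equal x z = if-true (==-refl x)

  J-dual : ∀ {x y} z → Dual x y → J x y z ≡ x ⊓ z
  J-dual z (dualPair x≠y x∂y) = trans (if-false x≠y) (if-true x∂y)

  J-unrelated : ∀ {x y} z → Unrelated x y → J x y z ≡ 𝟘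
  J-unrelated z (unrelatedPair x≠y x¬∂y) = trans (if-false x≠y) (if-false x¬∂y)

  J-zero : ∀ y z → J 𝟘 y z ≡ 𝟘
  J-zero y z = if-eta (_==_ 𝒯 𝟘 y)

  J'-equal : ∀ x z → J' x x z ≡ x ⊓ z
  J'-equal x z = if-true (==-refl x)

  J'-dual : ∀ {x y} z → Dual x y → J' x y z ≡ x
  J'-dual z (dualPair x≠y x∂y) = trans (if-false x≠y) (if-true x∂y)

  J'-zero : ∀ y z → J' 𝟘 y z ≡ 𝟘
  J'-zero y z with _==_ 𝒯 𝟘 y
  ... | true  = ⊓-zeroˡ z
  ... | false = refl

  K-dual : ∀ {x y} z → Dual x y → K x y z ≡ y
  K-dual z (dualPair _ x∂y) = if-true x∂y

  K-equal-dual : ∀ {x z} → Dual x z → K x x z ≡ z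
  K-equal-dual {x} {z} (dualPair _ x∂z) =
    trans (if-false (isDual-irrefl x)) (if-true (trans (cong (_∧ isDual 𝒯 x z) (==-refl x)) x∂z))

  K-idem : ∀ x → K x x x ≡ x
  K-idem x = trans (if-false (isDual-irrefl x))
    (trans (if-false (trans (cong (_∧ isDual 𝒯 x x) (==-refl x)) (isDual-irrefl x)))
      (trans (cong (_⊓ x) (⊓-idem x)) (⊓-idem x)))

  J-lower : ∀ x y z → J x y z ⊑ x
  J-lower x y z with position x y
  ... | equal x     = inj₁ (J-equal x z)
  ... | dual d      = subst (_⊑ x) (sym (J-dual z d)) (⊓-lowerˡ x z)
  ... | unrelated u = inj₂ (J-unrelated z u)

  J-dual-lower : ∀ {p q u} w → Dual p q → u ⊑ p → J u q w ≡ u ⊓ w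
  J-dual-lower w d (inj₁ refl) = J-dual w d
  J-dual-lower {q = q} w d (inj₂ refl) = trans (J-zero q w) (sym (⊓-zeroˡ w))

  fixed-via : (f : E → E) {u v : E} → u ≡ v → f v ≡ v → f u ≡ u
  fixed-via f refl fv≡v = fv≡v

  -- Identity: J(u,v,e₂(u,v,w)) = J(u,v,w), since e₂(u,v,w) = w whenever u = ∂v.
  S-body-diag : ∀ w → S-body 𝒯 w w w ≡ w
  S-body-diag w = trans (cong (λ u → join 𝒯 u u) (⊓-idem w)) (if-eta (_==_ 𝒯 w 𝟘))

  J-e₂ : ∀ u v w → J u v (e₂ u v w) ≡ J u v w
  J-e₂ u v w with position u v
  ... | equal u = trans (J-equal u _) (sym (J-equal u w))
  ... | dual d@(dualPair _ u∂v) =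
    trans (J-dual _ d) (trans (cong (u ⊓_) (trans (if-true u∂v) (S-body-diag w))) (sym (J-dual w d)))
  ... | unrelated n = trans (J-unrelated _ n) (sym (J-unrelated w n))

  -- Identities: u = J(p,q,x) is fixed by J(–,q,–) on itself and on elements
  -- J(p,q,y ∧ u) below it.  Used to link the two ends of a chain step.
  J-retract : ∀ p q x → J (J p q x) q (J p q x) ≡ J p q x
  J-retract p q x with position p q
  ... | equal p     = fixed-via (λ u → J u p u) (J-equal p x) (J-equal p p)
  ... | dual d      = trans (J-dual-lower _ d (J-lower p q x)) (⊓-idem _)
  ... | unrelated n = fixed-via (λ u → J u q u) (J-unrelated x n) (J-zero q 𝟘)

  J-retract-below : ∀ {p q u} y → Dual p q → u ⊑ p → J u q (J p q (y ⊓ u)) ≡ J p q (y ⊓ u)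
  J-retract-below {p} y d (inj₁ refl) = trans (J-dual _ d) (⊓-absorb (J-lower p _ (y ⊓ p)))
  J-retract-below {p} {q} y d (inj₂ refl) = trans (J-zero q (J p q (y ⊓ 𝟘)))
    (sym (trans (cong (J p q) (⊓-zeroʳ y)) (trans (J-dual 𝟘 d) (⊓-zeroʳ p))))

  J-retract-meet : ∀ p q x y →
    J (J p q x) q (J p q (y ⊓ J p q x)) ≡ J p q (y ⊓ J p q x)
  J-retract-meet p q x y with position p q
  ... | equal p = trans (cong (λ u → J u p (J p p (y ⊓ u))) (J-equal p x))
                    (trans (J-equal p _) (sym (J-equal p _)))
  ... | dual d  = J-retract-below y d (J-lower p q x)
  ... | unrelated n = trans (cong (λ u → J u q (J p q (y ⊓ J p q x))) (J-unrelated x n))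
                        (trans (J-zero q (J p q (y ⊓ J p q x))) (sym (J-unrelated (y ⊓ J p q x) n)))

  -- Identity: J'(â,ρ,J(â,ρ,x)) = â for â = hat a ρ; it shows anchor a ρ x q = a
  -- when a is linked to x by ρ.
  J'-collapse : ∀ a ρ x → J' (hat a ρ) ρ (J (hat a ρ) ρ x) ≡ hat a ρ
  J'-collapse a ρ x with position a ρ
  ... | equal a = fixed-via (λ u → J' u a (J u a x)) (J-equal a a)
                    (trans (J'-equal a (J a a x)) (trans (cong (a ⊓_) (J-equal a x)) (⊓-idem a)))
  ... | dual d = fixed-via (λ u → J' u ρ (J u ρ x)) (trans (J-dual a d) (⊓-idem a))
                   (J'-dual (J a ρ x) d)
  ... | unrelated n = fixed-via (λ u → J' u ρ (J u ρ x)) (J-unrelated a n) (J'-zero ρ (J 𝟘 ρ x))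

  tilde-lower : ∀ a ρ x q → tilde a ρ x q ⊑ hat a ρ
  tilde-lower a ρ x q = ⊑-trans (J-lower _ q _) (J-lower (hat a ρ) ρ x)

  Fixes : E → E → E → Set
  Fixes s r u = J s r s ≡ s × J s r u ≡ u

  fixes-≡ : ∀ {s s' r r' u u'} → s ≡ s' → r ≡ r' → u ≡ u' → Fixes s' r' u' → Fixes s r u
  fixes-≡ refl refl refl fixes = fixes

  fixes-zero : ∀ r → Fixes 𝟘 r 𝟘
  fixes-zero r = J-zero r 𝟘 , J-zero r 𝟘

  fixes-equal : ∀ a → Fixes a a a
  fixes-equal a = J-equal a a , J-equal a a

  fixes-dual : ∀ {a r u} → Dual a r → u ⊑ a → Fixes a r u
  fixes-dual {a} {u = u} d u⊑a = trans (J-dual a d) (⊓-idem a) , trans (J-dual u d) (⊓-absorb u⊑a)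

  -- The composition identity when ρ = a, where the anchor reduces to J(a,q,a).
  fixes-equal-case : ∀ a q y v → v ≡ J a q a → Fixes v (K v a q) (J v q y)
  fixes-equal-case a q y v v≡ with position a q
  ... | equal a = fixes-≡ v≡a (trans (cong (λ u → K u a a) v≡a) (K-idem a))
                    (trans (cong (λ u → J u a y) v≡a) (J-equal a y)) (fixes-equal a)
    where
    v≡a : v ≡ a
    v≡a = trans v≡ (J-equal a a)
  ... | dual d = fixes-≡ v≡a (trans (cong (λ u → K u a q) v≡a) (K-equal-dual d))
                   (cong (λ u → J u q y) v≡a) (fixes-dual d (J-lower a q y))
    where
    v≡a : v ≡ a
    v≡a = trans v≡ (trans (J-dual a d) (⊓-idem a))
  ... | unrelated n = fixes-≡ v≡𝟘 refl (trans (cong (λ u → J u q y) v≡𝟘) (J-zero q y))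
                        (fixes-zero (K v a q))
    where
    v≡𝟘 : v ≡ 𝟘
    v≡𝟘 = trans v≡ (J-unrelated a n)

  -- Identity: with s = anchor a ρ x q, J(s,K(s,ρ,q),–) fixes s and
  -- J(tilde a ρ x q, q, y).  This is the composition of links, in A'(𝒯).
  K-step : ∀ a ρ x q y →
    Fixes (anchor a ρ x q) (K (anchor a ρ x q) ρ q) (J (tilde a ρ x q) q y)
  K-step a ρ x q y with position a ρ
  ... | equal a =
    subst (λ w → Fixes w (K w a q) (J (tilde a a x q) q y)) (sym s≡x̃)
      (fixes-equal-case a q y (tilde a a x q) (cong (λ u → J u q u) x̂≡a))
    where
    â≡a : hat a a ≡ a
    â≡a = J-equal a a
    x̂≡a : J (hat a a) a x ≡ a
    x̂≡a = trans (cong (λ u → J u a x) â≡a) (J-equal a x)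
    s≡x̃ : anchor a a x q ≡ tilde a a x q
    s≡x̃ = trans (cong (λ u → J' u a (tilde a a x q)) â≡a)
             (trans (J'-equal a _) (⊓-absorb (subst (tilde a a x q ⊑_) â≡a (tilde-lower a a x q))))
  ... | dual d = fixes-≡ s≡a (trans (cong (λ u → K u ρ q) s≡a) (K-dual q d)) refl
                   (fixes-dual d (⊑-trans (J-lower _ q y) (subst (tilde a ρ x q ⊑_) â≡a (tilde-lower a ρ x q))))
    where
    â≡a : hat a ρ ≡ a
    â≡a = trans (J-dual a d) (⊓-idem a)
    s≡a : anchor a ρ x q ≡ a
    s≡a = trans (cong (λ u → J' u ρ (tilde a ρ x q)) â≡a) (J'-dual _ d)
  ... | unrelated n = fixes-≡ s≡𝟘 refl ŷ≡𝟘 (fixes-zero (K (anchor a ρ x q) ρ q))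
    where
    â≡𝟘 : hat a ρ ≡ 𝟘
    â≡𝟘 = J-unrelated a n
    x̃≡𝟘 : tilde a ρ x q ≡ 𝟘
    x̃≡𝟘 = ⊑-𝟘 (subst (tilde a ρ x q ⊑_) â≡𝟘 (tilde-lower a ρ x q))
    s≡𝟘 : anchor a ρ x q ≡ 𝟘
    s≡𝟘 = trans (cong (λ u → J' u ρ (tilde a ρ x q)) â≡𝟘) (J'-zero ρ (tilde a ρ x q))
    ŷ≡𝟘 : J (tilde a ρ x q) q y ≡ 𝟘
    ŷ≡𝟘 = trans (cong (λ u → J u q y) x̃≡𝟘) (J-zero q y)

-- Terms of the signature of A'(𝒯), and the fact that every identity of A'(𝒯)
-- holds in each member 𝔹 of 𝒱(A'(𝒯)) = HSP(A'(𝒯)): evaluate through a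
-- preimage in the subpower, where the identity holds coordinatewise.
module Terms (𝒯 : TM) where

  data Term (n : ℕ) : Set where
    var : Fin n → Term n
    app : (o : Op 𝒯) → Vec (Term n) (arity 𝒯 o) → Term n

  J̲ J̲' K̲ e̲₂ : ∀ {n} → Term n → Term n → Term n → Term n
  J̲ x y z = app oJ (x ∷ y ∷ z ∷ [])
  J̲' x y z = app oJ' (x ∷ y ∷ z ∷ [])
  K̲ x y z = app oK (x ∷ y ∷ z ∷ [])
  e̲₂ u v w = app oS₂ (u ∷ v ∷ w ∷ w ∷ w ∷ [])

  _⊓̲_ : ∀ {n} → Term n → Term n → Term n
  x ⊓̲ y = app o∧ (x ∷ y ∷ [])

  module Eval {c : Level} {X : Set c} (⟦_⟧ : (o : Op 𝒯) → Vec X (arity 𝒯 o) → X) where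
    eval : ∀ {n} → Term n → Vec X n → X
    evals : ∀ {n k} → Vec (Term n) k → Vec X n → Vec X k
    eval (var i) env = lookup env i
    eval (app o ts) env = ⟦ o ⟧ (evals ts env)
    evals [] env = []
    evals (t ∷ ts) env = eval t env ∷ evals ts env

  open Eval (⟦_⟧ᴬ 𝒯) public renaming (eval to evalᴬ; evals to evalsᴬ)

  module Transfer {a ℓ : Level} (𝔹 : Algebra 𝒯 a ℓ) (inV : InV 𝒯 𝔹) where
    open Algebra 𝔹
    open InV inV
    open IsEquivalence isEquivalence using (reflexive) renaming (trans to ≈-trans)
    open Eval ⟦_⟧ public renaming (eval to evalᴮ; evals to evalsᴮ)
    open Eval opS renaming (eval to evalˢ; evals to evalsˢ)

    setoid : Setoid a ℓ
    setoid = record { Carrier = Carrier ; _≈_ = _≈_ ; isEquivalence = isEquivalence }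

    open SetoidReasoning setoid

    eval-cong : ∀ {n} (t : Term n) {env env'} → Pointwise _≈_ env env' → evalᴮ t env ≈ evalᴮ t env'
    evals-cong : ∀ {n k} (ts : Vec (Term n) k) {env env'} → Pointwise _≈_ env env' →
                 Pointwise _≈_ (evalsᴮ ts env) (evalsᴮ ts env')
    eval-cong (var i) env≈ = Pointwise.lookup env≈ i
    eval-cong (app o ts) env≈ = ⟦⟧-cong o (evals-cong ts env≈)
    evals-cong [] env≈ = []
    evals-cong (t ∷ ts) env≈ = eval-cong t env≈ ∷ evals-cong ts env≈

    eval-h : ∀ {n} (t : Term n) env → h (evalˢ t env) ≈ evalᴮ t (map h env)
    evals-h : ∀ {n k} (ts : Vec (Term n) k) env →
              Pointwise _≈_ (map h (evalsˢ ts env)) (evalsᴮ ts (map h env))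
    eval-h (var i) env = reflexive (sym (lookup-map i h env))
    eval-h (app o ts) env = ≈-trans (h-hom o (evalsˢ ts env)) (⟦⟧-cong o (evals-h ts env))
    evals-h [] env = []
    evals-h (t ∷ ts) env = eval-h t env ∷ evals-h ts env

    eval-at : ∀ {n} (t : Term n) env κ →
              proj₁ (evalˢ t env) κ ≡ evalᴬ t (map (λ s → proj₁ s κ) env)
    evals-at : ∀ {n k} (ts : Vec (Term n) k) env κ →
               map (λ s → proj₁ s κ) (evalsˢ ts env) ≡ evalsᴬ ts (map (λ s → proj₁ s κ) env)
    eval-at (var i) env κ = sym (lookup-map i (λ s → proj₁ s κ) env)
    eval-at (app o ts) env κ = cong (⟦_⟧ᴬ 𝒯 o) (evals-at ts env κ)
    evals-at [] env κ = refl
    evals-at (t ∷ ts) env κ = cong₂ _∷_ (eval-at t env κ) (evals-at ts env κ)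

    preimages : ∀ {n} (bs : Vec Carrier n) → Σ (Vec S n) (λ ss → Pointwise _≈_ (map h ss) bs)
    preimages [] = [] , []
    preimages (b ∷ bs) with h-surj b | preimages bs
    ... | s , hs≈b | ss , hss≈bs = s ∷ ss , hs≈b ∷ hss≈bs

    identity : ∀ {n} (t u : Term n) → (∀ env → evalᴬ t env ≡ evalᴬ u env) →
               ∀ env → evalᴮ t env ≈ evalᴮ u env
    identity t u t≡u env with preimages env
    ... | ss , hss≈env = begin
      evalᴮ t env          ≈⟨ eval-cong t hss≈env ⟨
      evalᴮ t (map h ss)   ≈⟨ eval-h t ss ⟨
      h (evalˢ t ss)       ≈⟨ h-cong (evalˢ t ss) (evalˢ u ss) coordinatewise ⟩
      h (evalˢ u ss)       ≈⟨ eval-h u ss ⟩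
      evalᴮ u (map h ss)   ≈⟨ eval-cong u hss≈env ⟩
      evalᴮ u env          ∎
      where
      coordinatewise : ∀ κ → proj₁ (evalˢ t ss) κ ≡ proj₁ (evalˢ u ss) κ
      coordinatewise κ = trans (eval-at t ss κ) (trans (t≡u _) (sym (eval-at u ss κ)))

module InVariety (𝒯 : TM) {a ℓ : Level} (𝔹 : Algebra 𝒯 a ℓ) (inV : InV 𝒯 𝔹) where
  open Algebra 𝔹
  open Terms 𝒯
  open Transfer 𝔹 inV
  open SetoidReasoning setoid
  open IsEquivalence isEquivalence using () renaming (refl to ≈-refl; sym to ≈-sym; trans to ≈-trans)
  private
    module A = A′ 𝒯
    module T = Construction (J̲ {5}) (J̲' {5})

  J J' K : Carrier → Carrier → Carrier → Carrier
  J = Jᴮ 𝒯 𝔹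
  J' x y z = ⟦ oJ' ⟧ (x ∷ y ∷ z ∷ [])
  K x y z = ⟦ oK ⟧ (x ∷ y ∷ z ∷ [])

  _⊓_ : Carrier → Carrier → Carrier
  x ⊓ y = ⟦ o∧ ⟧ (x ∷ y ∷ [])

  e₂ : Carrier → Carrier → Carrier → Carrier
  e₂ = e₂ᴮ 𝒯 𝔹

  open Construction J J'

  J-cong : ∀ {x x' y y' z z'} → x ≈ x' → y ≈ y' → z ≈ z' → J x y z ≈ J x' y' z'
  J-cong x≈ y≈ z≈ = ⟦⟧-cong oJ (x≈ ∷ y≈ ∷ z≈ ∷ [])

  J'-cong : ∀ {x x' y z z'} → x ≈ x' → z ≈ z' → J' x y z ≈ J' x' y z'
  J'-cong x≈ z≈ = ⟦⟧-cong oJ' (x≈ ∷ ≈-refl ∷ z≈ ∷ [])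

  K-cong : ∀ {x x' y z} → x ≈ x' → K x y z ≈ K x' y z
  K-cong x≈ = ⟦⟧-cong oK (x≈ ∷ ≈-refl ∷ ≈-refl ∷ [])

  ⊓-congʳ : ∀ {x y y'} → y ≈ y' → (x ⊓ y) ≈ (x ⊓ y')
  ⊓-congʳ y≈ = ⟦⟧-cong o∧ (≈-refl ∷ y≈ ∷ [])

  J-diagᴮ : ∀ a w → J a a w ≈ a
  J-diagᴮ a w = identity (J̲ (var 0F) (var 0F) (var 1F)) (var 0F)
    (λ { (a ∷ w ∷ []) → A.J-equal a w }) (a ∷ w ∷ [])

  J-e₂ᴮ : ∀ u v w → J u v (e₂ u v w) ≈ J u v w
  J-e₂ᴮ u v w = identity (J̲ (var 0F) (var 1F) (e̲₂ (var 0F) (var 1F) (var 2F)))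
    (J̲ (var 0F) (var 1F) (var 2F)) (λ { (u ∷ v ∷ w ∷ []) → A.J-e₂ u v w }) (u ∷ v ∷ w ∷ [])

  J-retractᴮ : ∀ p q x → J (J p q x) q (J p q x) ≈ J p q x
  J-retractᴮ p q x = identity (J̲ u (var 1F) u) u
    (λ { (p ∷ q ∷ x ∷ []) → A.J-retract p q x }) (p ∷ q ∷ x ∷ [])
    where
    u : Term 3
    u = J̲ (var 0F) (var 1F) (var 2F)

  J-retract-meetᴮ : ∀ p q x y → J (J p q x) q (J p q (y ⊓ J p q x)) ≈ J p q (y ⊓ J p q x)
  J-retract-meetᴮ p q x y = identity (J̲ u (var 1F) v) v
    (λ { (p ∷ q ∷ x ∷ y ∷ []) → A.J-retract-meet p q x y }) (p ∷ q ∷ x ∷ y ∷ [])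
    where
    u v : Term 4
    u = J̲ (var 0F) (var 1F) (var 2F)
    v = J̲ (var 0F) (var 1F) (var 3F ⊓̲ u)

  J'-collapseᴮ : ∀ a ρ x → J' (hat a ρ) ρ (J (hat a ρ) ρ x) ≈ hat a ρ
  J'-collapseᴮ a ρ x = identity (J̲' â (var 1F) (J̲ â (var 1F) (var 2F))) â
    (λ { (a ∷ ρ ∷ x ∷ []) → A.J'-collapse a ρ x }) (a ∷ ρ ∷ x ∷ [])
    where
    â : Term 3
    â = J̲ (var 0F) (var 1F) (var 0F)

  K-stepᴮ : ∀ a ρ x q y →
    let s = anchor a ρ x q ; r = K s ρ q ; ŷ = J (tilde a ρ x q) q y in
    J s r s ≈ s × J s r ŷ ≈ ŷ
  K-stepᴮ a ρ x q y =
    identity (J̲ s r s) s (λ { (a ∷ ρ ∷ x ∷ q ∷ y ∷ []) → proj₁ (A.K-step a ρ x q y) }) env ,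
    identity (J̲ s r ŷ) ŷ (λ { (a ∷ ρ ∷ x ∷ q ∷ y ∷ []) → proj₂ (A.K-step a ρ x q y) }) env
    where
    env : Vec Carrier 5
    env = a ∷ ρ ∷ x ∷ q ∷ y ∷ []
    s r ŷ : Term 5
    s = T.anchor (var 0F) (var 1F) (var 2F) (var 3F)
    r = K̲ s (var 1F) (var 3F)
    ŷ = J̲ (T.tilde (var 0F) (var 1F) (var 2F) (var 3F)) (var 3F) (var 4F)

  Linked : Carrier → Carrier → Carrier → Set ℓ
  Linked a ρ x = a ≈ J a ρ a × x ≈ J a ρ x

  linked-refl : ∀ a → Linked a a a
  linked-refl a = ≈-sym (J-diagᴮ a a) , ≈-sym (J-diagᴮ a a)

  linked-step : ∀ {p q x y} → (y ⊓ x) ≈ y → x ≈ J p q x → y ≈ J p q y → Linked x q y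
  linked-step {p} {q} {x} {y} y≤x x≈ y≈ = x-fixed , y-fixed
    where
    y≈ỹ : y ≈ J p q (y ⊓ J p q x)
    y≈ỹ = begin
      y                    ≈⟨ y≈ ⟩
      J p q y              ≈⟨ J-cong ≈-refl ≈-refl y≤x ⟨
      J p q (y ⊓ x)        ≈⟨ J-cong ≈-refl ≈-refl (⊓-congʳ x≈) ⟩
      J p q (y ⊓ J p q x)  ∎
    x-fixed : x ≈ J x q x
    x-fixed = begin
      x                        ≈⟨ x≈ ⟩
      J p q x                  ≈⟨ J-retractᴮ p q x ⟨
      J (J p q x) q (J p q x)  ≈⟨ J-cong x≈ ≈-refl x≈ ⟨
      J x q x                  ∎
    y-fixed : y ≈ J x q y
    y-fixed = begin
      y                                    ≈⟨ y≈ỹ ⟩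
      J p q (y ⊓ J p q x)                  ≈⟨ J-retract-meetᴮ p q x y ⟨
      J (J p q x) q (J p q (y ⊓ J p q x))  ≈⟨ J-cong x≈ ≈-refl y≈ỹ ⟨
      J x q y                              ∎

  -- Links compose: a —ρ→ x and x —q→ y give a —K(a,ρ,q)→ y.  The identities
  -- apply to the normal forms â, x̃, anchor, which equal a, x, a here.
  linked-trans : ∀ {a ρ x q y} → Linked a ρ x → Linked x q y → Linked a (K a ρ q) y
  linked-trans {a} {ρ} {x} {q} {y} (a≈â , x≈) (x≈' , y≈) = a-fixed , y-fixed
    where
    x≈x̂ : x ≈ J (hat a ρ) ρ x
    x≈x̂ = ≈-trans x≈ (J-cong a≈â ≈-refl ≈-refl)
    x≈x̃ : x ≈ tilde a ρ x q
    x≈x̃ = ≈-trans x≈' (J-cong x≈x̂ ≈-refl x≈x̂)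
    y≈ŷ : y ≈ J (tilde a ρ x q) q y
    y≈ŷ = ≈-trans y≈ (J-cong x≈x̃ ≈-refl ≈-refl)
    a≈s : a ≈ anchor a ρ x q
    a≈s = begin
      a                                   ≈⟨ a≈â ⟩
      hat a ρ                             ≈⟨ J'-collapseᴮ a ρ x ⟨
      J' (hat a ρ) ρ (J (hat a ρ) ρ x)    ≈⟨ J'-cong ≈-refl (≈-trans (≈-sym x≈x̂) x≈x̃) ⟩
      anchor a ρ x q                      ∎
    s≈a : anchor a ρ x q ≈ a
    s≈a = ≈-sym a≈s
    a-fixed : a ≈ J a (K a ρ q) a
    a-fixed = begin
      a                                                           ≈⟨ a≈s ⟩
      anchor a ρ x q                                              ≈⟨ proj₁ (K-stepᴮ a ρ x q y) ⟨
      J (anchor a ρ x q) (K (anchor a ρ x q) ρ q) (anchor a ρ x q) ≈⟨ J-cong s≈a (K-cong s≈a) s≈a ⟩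
      J a (K a ρ q) a                                             ∎
    y-fixed : y ≈ J a (K a ρ q) y
    y-fixed = begin
      y                                                  ≈⟨ y≈ŷ ⟩
      J (tilde a ρ x q) q y                              ≈⟨ proj₂ (K-stepᴮ a ρ x q y) ⟨
      J (anchor a ρ x q) (K (anchor a ρ x q) ρ q) (J (tilde a ρ x q) q y)
                                                         ≈⟨ J-cong s≈a (K-cong s≈a) (≈-sym y≈ŷ) ⟩
      J a (K a ρ q) y                                    ∎

  linked-e₂ : ∀ {a ρ x} → Linked a ρ x → a ≈ J a ρ (e₂ a ρ a) × x ≈ J a ρ (e₂ a ρ x)
  linked-e₂ {a} {ρ} {x} (a≈ , x≈) = ≈-trans a≈ (≈-sym (J-e₂ᴮ a ρ a)) , ≈-trans x≈ (≈-sym (J-e₂ᴮ a ρ x))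

lemma4p11 : (𝒯 : TM) {a ℓ : Level} (𝔹 : Algebra 𝒯 a ℓ) → InV 𝒯 𝔹 →
    (c d : Algebra.Carrier 𝔹) (m : ℕ) (r p q : ℕ → Algebra.Carrier 𝔹) →
    ((i : ℕ) → i < m → _≤ᴮ_ 𝒯 𝔹 (r (suc i)) (r i)) →
    ((i : ℕ) → i < m → Cg 𝒯 𝔹 c d (r i) (r (suc i))) →
    ((i : ℕ) → i < m →
      Algebra._≈_ 𝔹 (r i) (Jᴮ 𝒯 𝔹 (p i) (q i) (r i))
      × Algebra._≈_ 𝔹 (r (suc i)) (Jᴮ 𝒯 𝔹 (p i) (q i) (r (suc i)))) →
    ∃ λ ρ →
      Algebra._≈_ 𝔹 (r zero) (Jᴮ 𝒯 𝔹 (r zero) ρ (e₂ᴮ 𝒯 𝔹 (r zero) ρ (r zero)))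
      × Algebra._≈_ 𝔹 (r m) (Jᴮ 𝒯 𝔹 (r zero) ρ (e₂ᴮ 𝒯 𝔹 (r zero) ρ (r m)))
lemma4p11 𝒯 𝔹 inV c d m r p q descending _ cut = ρ m , linked-e₂ (chain m ≤-refl)
  where
  open Algebra 𝔹 using (Carrier)
  open InVariety 𝒯 𝔹 inV

  ρ : ℕ → Carrier
  ρ zero = r zero
  ρ (suc i) = K (r zero) (ρ i) (q i)

  chain : ∀ i → i ≤ m → Linked (r zero) (ρ i) (r i)
  chain zero _ = linked-refl (r zero)
  chain (suc i) i<m = linked-trans (chain i (<⇒≤ i<m))
    (linked-step (descending i i<m) (proj₁ (cut i i<m)) (proj₂ (cut i i<m)))
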